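{- Let $((U_n)_{n\in\mathbb{N}},(B_n)_{n\in\mathbb{N}},R)$ be an ercs of a represented space $\mathbf{X}$. Then $(U_n)_{n\in\mathbb{N}}$ is an effective countable basis of $\mathbf{X}$.
   Context: A represented space $\mathbf{X}=(X,\delta_X)$ is a set with a partial surjection $\delta_X:\subseteq\mathbb{N}^\mathbb{N}\to X$; computability of (multi-valued) maps means having computable realizers. $\mathbb{S}=\{\top,\bot\}$ is Sierpiński space ($p$ names $\top$ iff $p$ has a nonzero entry). $\mathcal{O}(\mathbf{X})$: open subsets, identified with characteristic maps $\mathbf{X}\to\mathbb{S}$. $\mathcal{K}(\mathbf{X})$: compact subsets $K$ represented by $U\mapsto\top$ iff $K\subseteq U$. An effective countable basis of $\mathbf{X}$ is a computable sequence $(V_n)_n$ in $\mathcal{O}(\mathbf{X})$ such that the multi-valued map taking $x\in\mathbf{X}$ and $U\in\mathcal{O}(\mathbf{X})$ with $x\in U$ to some $n$ with $x\in V_n\subseteq U$ is computable. An effective relatively compact system (ercs) of $\mathbf{X}$ is a triple $((U_n)_{n\in\mathbb{N}},(B_n)_{n\in\mathbb{N}},R)$ where $(U_n)_n$ is a computable sequence in $\mathcal{O}(\mathbf{X})$, $(B_n)_n$ is a computable sequence in $\mathcal{K}(\mathbf{X})$, and $R\subseteq\mathbb{N}\times\mathbb{N}$ is a computably enumerable relation such that $(m,n)\in R$ implies $U_m\subseteq B_n$, and such that for every open $U\in\mathcal{O}(\mathbf{X})$: $U=\bigcup_{\{n\mid U\supseteq B_n\}}\bigcup_{\{m\mid (m,n)\in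 R\}}U_m$. -}

module Defs where

open import Level using (Level; _⊔_) renaming (suc to lsuc; zero to lzero)
open import Data.Nat using (ℕ; zero; suc; _+_; _<_)
open import Data.Fin using (Fin)
open import Data.Vec using (Vec; []; _∷_; lookup)
open import Data.List using (List; []; _∷_)
open import Data.Product using (Σ; ∃; _×_; _,_)
open import Relation.Binary.PropositionalEquality using (_≡_; _≢_)

Baire : Set
Baire = ℕ → ℕ

-- Partial μ-recursive functions ℕⁿ ⇀ ℕ (Kleene), with big-step semantics.

data Code : ℕ → Set where
  zer  : ∀ {n} → Code n
  succ : Code 1
  proj : ∀ {n} → Fin n → Code n
  comp : ∀ {m n} → Code m → Vec (Code n) m → Code n
  prec : ∀ {n} → Code n → Code (suc (suc n)) → Code (suc n)
  mu   : ∀ {n} → Code (suc n) → Code n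

mutual
  data Eval : ∀ {n} → Code n → Vec ℕ n → ℕ → Set where
    ev-zer  : ∀ {n} {xs : Vec ℕ n} → Eval zer xs 0
    ev-succ : ∀ {x} → Eval succ (x ∷ []) (suc x)
    ev-proj : ∀ {n} {xs : Vec ℕ n} (i : Fin n) → Eval (proj i) xs (lookup xs i)
    ev-comp : ∀ {m n} {f : Code m} {gs : Vec (Code n) m} {xs : Vec ℕ n} {ys : Vec ℕ m} {y : ℕ} →
              EvalVec gs xs ys → Eval f ys y → Eval (comp f gs) xs y
    ev-prec0 : ∀ {n} {f : Code n} {g : Code (suc (suc n))} {xs : Vec ℕ n} {y : ℕ} →
               Eval f xs y → Eval (prec f g) (0 ∷ xs) y
    ev-precS : ∀ {n} {f : Code n} {g : Code (suc (suc n))} {xs : Vec ℕ n} {k y z : ℕ} →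
               Eval (prec f g) (k ∷ xs) y → Eval g (k ∷ y ∷ xs) z →
               Eval (prec f g) (suc k ∷ xs) z
    ev-mu   : ∀ {n} {f : Code (suc n)} {xs : Vec ℕ n} {y : ℕ} →
              Eval f (y ∷ xs) 0 →
              (∀ i → i < y → ∃ λ v → Eval f (i ∷ xs) (suc v)) →
              Eval (mu f) xs y

  data EvalVec : ∀ {m n} → Vec (Code n) m → Vec ℕ n → Vec ℕ m → Set where
    evv-[] : ∀ {n} {xs : Vec ℕ n} → EvalVec [] xs []
    evv-∷  : ∀ {m n} {g : Code n} {gs : Vec (Code n) m} {xs : Vec ℕ n} {y : ℕ} {ys : Vec ℕ m} →
             Eval g xs y → EvalVec gs xs ys → EvalVec (g ∷ gs) xs (y ∷ ys)

ComputableBaire : Baire → Set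
ComputableBaire h = ∃ λ (e : Code 1) → ∀ k → Eval e (k ∷ []) (h k)

-- A relation on ℕ is computably enumerable (domain of a partial recursive function).
IsCE : (ℕ → ℕ → Set) → Set
IsCE R = ∃ λ (e : Code 2) → ∀ m n →
  (R m n → ∃ λ y → Eval e (m ∷ n ∷ []) y) × ((∃ λ y → Eval e (m ∷ n ∷ []) y) → R m n)

tri : ℕ → ℕ
tri zero    = zero
tri (suc n) = suc n + tri n

pair : ℕ → ℕ → ℕ
pair x y = tri (x + y) + y

⌜_⌝ : List ℕ → ℕ
⌜ [] ⌝     = 0
⌜ x ∷ xs ⌝ = suc (pair x ⌜ xs ⌝)

prefix : Baire → ℕ → List ℕ
prefix p zero    = []
prefix p (suc n) = p 0 ∷ prefix (λ i → p (suc i)) n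

-- The continuous partial map F_h : Baire ⇀ Baire with associate h:
-- F_h(p)(k) = y  iff  h⟨k, p[0..n)⟩ = y+1 for the least n with a nonzero value.
AssocVal : Baire → Baire → ℕ → ℕ → Set
AssocVal h p k y = ∃ λ n → (h ⌜ k ∷ prefix p n ⌝ ≡ suc y) ×
                           (∀ m → m < n → h ⌜ k ∷ prefix p m ⌝ ≡ 0)

AssocMap : Baire → Baire → Baire → Set
AssocMap h p q = ∀ k → AssocVal h p k (q k)

-- Interleaving ⟨p,q⟩ of two names (name of a pair in a product space).
merge : Baire → Baire → Baire
merge p q zero          = p 0
merge p q (suc zero)    = q 0
merge p q (suc (suc k)) = merge (λ i → p (suc i)) (λ i → q (suc i)) k

record RepSpace : Set₁ where
  field
    Carrier    : Set
    _names_    : Baire → Carrier → Set            -- graph of δ_X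
    single     : ∀ {p x y} → p names x → p names y → x ≡ y
    surjective : ∀ x → ∃ λ p → p names x

module _ (X : RepSpace) where
  open RepSpace X

  -- Sierpiński space: p names ⊤ iff p has a nonzero entry.
  Top : Baire → Set
  Top r = ∃ λ n → r n ≢ 0

  Subset : Set₁
  Subset = Carrier → Set

  _⊆_ : Subset → Subset → Set
  A ⊆ B = ∀ x → A x → B x

  -- O(X): q names the open U iff q is (an associate of) a realizer of χ_U : X → 𝕊.
  NamesO : Baire → Subset → Set
  NamesO q U = ∀ p x → p names x →
    ∃ λ r → AssocMap q p r × ((Top r → U x) × (U x → Top r))

  IsOpen : Subset → Set
  IsOpen U = ∃ λ q → NamesO q U

  -- K(X): h names K iff h realizes  O(X) → 𝕊, U ↦ (K ⊆ U).
  NamesK : Baire → Subset → Set₁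
  NamesK h K = ∀ q (U : Subset) → NamesO q U →
    ∃ λ r → AssocMap h q r × ((Top r → K ⊆ U) × (K ⊆ U → Top r))

  -- Computable sequences ℕ → O(X) and ℕ → K(X)  (ℕ represented by p ↦ p 0).
  ComputableSeqO : (ℕ → Subset) → Set
  ComputableSeqO U = ∃ λ a → ComputableBaire a × (∀ n p → p 0 ≡ n →
    ∃ λ r → AssocMap a p r × NamesO r (U n))

  ComputableSeqK : (ℕ → Subset) → Set₁
  ComputableSeqK B = ∃ λ a → ComputableBaire a × (∀ n p → p 0 ≡ n →
    ∃ λ r → AssocMap a p r × NamesK r (B n))

  IsERCS : (ℕ → Subset) → (ℕ → Subset) → (ℕ → ℕ → Set) → Set₁
  IsERCS U B R =
    ComputableSeqO U × ComputableSeqK B × IsCE R ×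
    (∀ m n → R m n → U m ⊆ B n) ×
    (∀ V → IsOpen V → ∀ x →
       (V x → ∃ λ n → (B n ⊆ V) × ∃ λ m → R m n × U m x) ×
       ((∃ λ n → (B n ⊆ V) × ∃ λ m → R m n × U m x) → V x))

  IsEffectiveBasis : (ℕ → Subset) → Set₁
  IsEffectiveBasis V = ComputableSeqO V ×
    ∃ λ a → ComputableBaire a ×
      (∀ (x : Carrier) (U : Subset) p q → p names x → NamesO q U → U x →
         ∃ λ r → AssocMap a (merge p q) r × V (r 0) x × (V (r 0) ⊆ U))

module Submission where

-- Given names p of x and q of an open V ∋ x, the realizer
-- searches for a pair (m, n) such that
--   * R m n holds                       (semi-decided by running the code of R),
--   * the name of Uₘ accepts p          (x ∈ Uₘ, witnessed by a nonzero digit),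
--   * the name of Bₙ accepts q          (Bₙ ⊆ V, witnessed by a nonzero digit),
-- and outputs m.  Then x ∈ Uₘ ⊆ Bₙ ⊆ V; conversely the covering property of
-- the ercs guarantees that such a pair exists, so the search succeeds.
--
-- All the searches are made total by a step budget that grows with the length
-- of the input prefix, so the realizer is a total computable function.
--
-- Notation: a witness ending in ᵖ (as in addᵖ) proves that the function it
-- mentions is computed by some code.

open import Defs
open import Data.Nat
open import Data.Nat.Properties
open import Data.Empty using (⊥-elim)
open import Data.Fin using (Fin) renaming (zero to fz; suc to fs)
open import Data.Vec using (Vec; []; _∷_; lookup; map; tabulate)
open import Data.List using ([]; _∷_)
open import Data.Vec.Properties using (tabulate∘lookup; tabulate-cong)
open import Data.Product using (Σ; ∃; _×_; _,_; proj₁; proj₂)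
open import Data.Sum using (inj₁; inj₂)
open import Relation.Binary.PropositionalEquality
open import Relation.Binary.Definitions using (tri<; tri≈; tri>)
open import Relation.Nullary using (yes; no)

Computable : (n : ℕ) → (Vec ℕ n → ℕ) → Set
Computable n f = Σ (Code n) λ c → ∀ xs → Eval c xs (f xs)

computable-ext : ∀ {n} {f g : Vec ℕ n → ℕ} → (∀ xs → f xs ≡ g xs) → Computable n f → Computable n g
computable-ext eq (c , ev) = c , λ xs → subst (Eval c xs) (eq xs) (ev xs)

zeroᵖ : ∀ {n} → Computable n (λ _ → 0)
zeroᵖ = zer , λ xs → ev-zer

succᵖ : Computable 1 (λ { (x ∷ []) → suc x })
succᵖ = succ , λ { (x ∷ []) → ev-succ }

projᵖ : ∀ {n} (i : Fin n) → Computable n (λ xs → lookup xs i)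
projᵖ i = proj i , λ xs → ev-proj i

infixr 5 _∷ᵖ_
data AllComputable {n : ℕ} : ∀ {m} → Vec (Vec ℕ n → ℕ) m → Set where
  []ᵖ  : AllComputable []
  _∷ᵖ_ : ∀ {m g} {gs : Vec (Vec ℕ n → ℕ) m} → Computable n g → AllComputable gs → AllComputable (g ∷ gs)

codes : ∀ {n m} {gs : Vec (Vec ℕ n → ℕ) m} → AllComputable gs → Vec (Code n) m
codes []ᵖ = []
codes ((c , _) ∷ᵖ ps) = c ∷ codes ps

eval-codes : ∀ {n m} {gs : Vec (Vec ℕ n → ℕ) m} (ps : AllComputable gs) (xs : Vec ℕ n) →
             EvalVec (codes ps) xs (map (λ g → g xs) gs)
eval-codes []ᵖ xs = evv-[]
eval-codes ((c , e) ∷ᵖ ps) xs = evv-∷ (e xs) (eval-codes ps xs)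

compᵖ : ∀ {n m} {f : Vec ℕ m → ℕ} {gs : Vec (Vec ℕ n → ℕ) m} →
        Computable m f → AllComputable gs → Computable n (λ xs → f (map (λ g → g xs) gs))
compᵖ (c , e) ps = comp c (codes ps) , λ xs → ev-comp (eval-codes ps xs) (e _)

recᵖ : ∀ {n} {f : Vec ℕ n → ℕ} {g : Vec ℕ (suc (suc n)) → ℕ} →
       Computable n f → Computable (suc (suc n)) g → (h : Vec ℕ (suc n) → ℕ) →
       (∀ xs → h (zero ∷ xs) ≡ f xs) → (∀ k xs → h (suc k ∷ xs) ≡ g (k ∷ h (k ∷ xs) ∷ xs)) →
       Computable (suc n) h
recᵖ {f = f} {g} (cf , ef) (cg , eg) h h-zero h-suc = prec cf cg , eval
  where
  eval : ∀ xs → Eval (prec cf cg) xs (h xs)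
  eval (zero ∷ xs) = subst (Eval (prec cf cg) (zero ∷ xs)) (sym (h-zero xs)) (ev-prec0 (ef xs))
  eval (suc k ∷ xs) = subst (Eval (prec cf cg) (suc k ∷ xs)) (sym (h-suc k xs)) (ev-precS (eval (k ∷ xs)) (eg _))

uncurry₁ : (ℕ → ℕ) → Vec ℕ 1 → ℕ
uncurry₁ f (x ∷ []) = f x

uncurry₂ : (ℕ → ℕ → ℕ) → Vec ℕ 2 → ℕ
uncurry₂ f (x ∷ y ∷ []) = f x y

uncurry₃ : (ℕ → ℕ → ℕ → ℕ) → Vec ℕ 3 → ℕ
uncurry₃ f (x ∷ y ∷ z ∷ []) = f x y z

π0 : ∀ {n} → Computable (suc n) (λ { (x ∷ _) → x })
π0 = computable-ext (λ { (x ∷ _) → refl }) (projᵖ fz)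

π1 : ∀ {n} → Computable (suc (suc n)) (λ { (_ ∷ x ∷ _) → x })
π1 = computable-ext (λ { (_ ∷ x ∷ _) → refl }) (projᵖ (fs fz))

π2 : ∀ {n} → Computable (suc (suc (suc n))) (λ { (_ ∷ _ ∷ x ∷ _) → x })
π2 = computable-ext (λ { (_ ∷ _ ∷ x ∷ _) → refl }) (projᵖ (fs (fs fz)))

π3 : ∀ {n} → Computable (suc (suc (suc (suc n)))) (λ { (_ ∷ _ ∷ _ ∷ x ∷ _) → x })
π3 = computable-ext (λ { (_ ∷ _ ∷ _ ∷ x ∷ _) → refl }) (projᵖ (fs (fs (fs fz))))

π4 : ∀ {n} → Computable (suc (suc (suc (suc (suc n))))) (λ { (_ ∷ _ ∷ _ ∷ _ ∷ x ∷ _) → x })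
π4 = computable-ext (λ { (_ ∷ _ ∷ _ ∷ _ ∷ x ∷ _) → refl }) (projᵖ (fs (fs (fs (fs fz)))))

comp₁ : ∀ {n} {f : Vec ℕ 1 → ℕ} {g : Vec ℕ n → ℕ} →
        Computable 1 f → Computable n g → Computable n (λ xs → f (g xs ∷ []))
comp₁ pf pg = compᵖ pf (pg ∷ᵖ []ᵖ)

comp₂ : ∀ {n} {f : Vec ℕ 2 → ℕ} {g h : Vec ℕ n → ℕ} → Computable 2 f → Computable n g → Computable n h →
        Computable n (λ xs → f (g xs ∷ h xs ∷ []))
comp₂ pf pg ph = compᵖ pf (pg ∷ᵖ ph ∷ᵖ []ᵖ)

comp₃ : ∀ {n} {f : Vec ℕ 3 → ℕ} {g h k : Vec ℕ n → ℕ} →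
        Computable 3 f → Computable n g → Computable n h → Computable n k →
        Computable n (λ xs → f (g xs ∷ h xs ∷ k xs ∷ []))
comp₃ pf pg ph pk = compᵖ pf (pg ∷ᵖ ph ∷ᵖ pk ∷ᵖ []ᵖ)

constᵖ : ∀ {n} (k : ℕ) → Computable n (λ _ → k)
constᵖ zero = zeroᵖ
constᵖ (suc k) = comp₁ succᵖ (constᵖ k)

sucᵖ : Computable 1 (uncurry₁ suc)
sucᵖ = computable-ext (λ { (x ∷ []) → refl }) succᵖ

addᵖ : Computable 2 (uncurry₂ _+_)
addᵖ = recᵖ π0 (comp₁ sucᵖ π1) (uncurry₂ _+_) (λ { (y ∷ []) → refl }) (λ { x (y ∷ []) → refl })

mulᵖ : Computable 2 (uncurry₂ _*_)
mulᵖ = recᵖ zeroᵖ (comp₂ addᵖ π2 π1) (uncurry₂ _*_) (λ { (y ∷ []) → refl }) (λ { x (y ∷ []) → refl })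

predᵖ : Computable 1 (uncurry₁ pred)
predᵖ = recᵖ zeroᵖ π0 (uncurry₁ pred) (λ { [] → refl }) (λ { x [] → refl })

monusᵖ : Computable 2 (uncurry₂ _∸_)
monusᵖ = computable-ext (λ { (x ∷ y ∷ []) → refl }) (comp₂ flipped π1 π0)
  where
  flipped : Computable 2 (uncurry₂ (λ y x → x ∸ y))
  flipped = recᵖ π0 (comp₁ predᵖ π1) _ (λ { (x ∷ []) → refl })
              (λ { y (x ∷ []) → sym (pred[m∸n]≡m∸[1+n] x y) })

ifnz : ℕ → ℕ → ℕ → ℕ
ifnz zero a b = b
ifnz (suc _) a b = a

ifnzᵖ : Computable 3 (uncurry₃ ifnz)
ifnzᵖ = recᵖ π1 π2 (uncurry₃ ifnz) (λ { (a ∷ b ∷ []) → refl }) (λ { c (a ∷ b ∷ []) → refl })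

isz : ℕ → ℕ
isz zero = 1
isz (suc _) = 0

iszᵖ : Computable 1 (uncurry₁ isz)
iszᵖ = computable-ext (λ { (zero ∷ []) → refl ; (suc x ∷ []) → refl })
         (comp₃ ifnzᵖ π0 (constᵖ 0) (constᵖ 1))

leq : ℕ → ℕ → ℕ
leq x y = isz (x ∸ y)

leqᵖ : Computable 2 (uncurry₂ leq)
leqᵖ = computable-ext (λ { (x ∷ y ∷ []) → refl }) (comp₁ iszᵖ monusᵖ)

leq-yes : ∀ {x y} → x ≤ y → leq x y ≡ 1
leq-yes x≤y rewrite m≤n⇒m∸n≡0 x≤y = refl

leq-no : ∀ {x y} → y < x → leq x y ≡ 0
leq-no {x} {y} y<x with x ∸ y | m>n⇒m∸n≢0 y<x
... | zero  | x∸y≢0 = ⊥-elim (x∸y≢0 refl)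
... | suc _ | _     = refl

triᵖ : Computable 1 (uncurry₁ tri)
triᵖ = recᵖ zeroᵖ (comp₂ addᵖ (comp₁ succᵖ π0) π1) (uncurry₁ tri) (λ { [] → refl }) (λ { x [] → refl })

pairᵖ : Computable 2 (uncurry₂ pair)
pairᵖ = computable-ext (λ { (x ∷ y ∷ []) → refl }) (comp₂ addᵖ (comp₁ triᵖ addᵖ) π1)

-- Inverting the pairing function: diag c is the largest d with tri d ≤ c,
-- computed by primitive recursion on c.
diag : ℕ → ℕ
diag zero = zero
diag (suc c) = ifnz (leq (tri (suc (diag c))) (suc c)) (suc (diag c)) (diag c)

diagᵖ : Computable 1 (uncurry₁ diag)
diagᵖ = recᵖ zeroᵖ
          (comp₃ ifnzᵖ (comp₂ leqᵖ (comp₁ triᵖ (comp₁ sucᵖ π1)) (comp₁ sucᵖ π0)) (comp₁ sucᵖ π1) π1)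
          (uncurry₁ diag) (λ { [] → refl }) (λ { k [] → refl })

diag-bounds : ∀ c → tri (diag c) ≤ c × c < tri (suc (diag c))
diag-bounds zero = z≤n , s≤s z≤n
diag-bounds (suc c) with diag-bounds c | tri (suc (diag c)) ≤? suc c
... | lo , hi | yes le rewrite leq-yes le = le , (begin-strict
        suc c                                   ≤⟨ hi ⟩
        tri (suc (diag c))                      <⟨ m<n+m (tri (suc (diag c))) {suc (suc (diag c))} (s≤s z≤n) ⟩
        suc (suc (diag c)) + tri (suc (diag c)) ∎)
  where open ≤-Reasoning
... | lo , hi | no nle rewrite leq-no (≰⇒> nle) = m≤n⇒m≤1+n lo , ≰⇒> nle

tri-mono : ∀ {m n} → m ≤ n → tri m ≤ tri n
tri-mono {zero} _ = z≤n
tri-mono {suc m} {suc n} (s≤s m≤n) = +-mono-≤ (s≤s m≤n) (tri-mono m≤n)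

diag-unique : ∀ {c d} → tri d ≤ c → c < tri (suc d) → diag c ≡ d
diag-unique {c} {d} lo hi with <-cmp (diag c) d
... | tri≈ _ e _ = e
... | tri< lt _ _ = ⊥-elim (<-irrefl refl (<-≤-trans (proj₂ (diag-bounds c)) (≤-trans (tri-mono lt) lo)))
... | tri> _ _ gt = ⊥-elim (<-irrefl refl (<-≤-trans hi (≤-trans (tri-mono gt) (proj₁ (diag-bounds c)))))

diag-pair : ∀ x y → diag (pair x y) ≡ x + y
diag-pair x y = diag-unique (m≤m+n (tri (x + y)) y) (begin-strict
  tri (x + y) + y           <⟨ +-monoʳ-< (tri (x + y)) (s≤s (m≤n+m y x)) ⟩
  tri (x + y) + suc (x + y) ≡⟨ +-comm (tri (x + y)) _ ⟩
  tri (suc (x + y))         ∎)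
  where open ≤-Reasoning

unpair₂ : ℕ → ℕ
unpair₂ c = c ∸ tri (diag c)

unpair₁ : ℕ → ℕ
unpair₁ c = diag c ∸ unpair₂ c

unpair₂-pair : ∀ x y → unpair₂ (pair x y) ≡ y
unpair₂-pair x y rewrite diag-pair x y = m+n∸m≡n (tri (x + y)) y

unpair₁-pair : ∀ x y → unpair₁ (pair x y) ≡ x
unpair₁-pair x y rewrite unpair₂-pair x y | diag-pair x y = m+n∸n≡m x y

unpair₂ᵖ : Computable 1 (uncurry₁ unpair₂)
unpair₂ᵖ = computable-ext (λ { (x ∷ []) → refl }) (comp₂ monusᵖ π0 (comp₁ triᵖ (comp₁ diagᵖ π0)))

unpair₁ᵖ : Computable 1 (uncurry₁ unpair₁)
unpair₁ᵖ = computable-ext (λ { (x ∷ []) → refl }) (comp₂ monusᵖ (comp₁ diagᵖ π0) (comp₁ unpair₂ᵖ π0))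

cons : ℕ → ℕ → ℕ
cons x l = suc (pair x l)

hd : ℕ → ℕ
hd l = unpair₁ (pred l)

tl : ℕ → ℕ
tl l = unpair₂ (pred l)

consᵖ : Computable 2 (uncurry₂ cons)
consᵖ = computable-ext (λ { (x ∷ y ∷ []) → refl }) (comp₁ sucᵖ pairᵖ)

hdᵖ : Computable 1 (uncurry₁ hd)
hdᵖ = computable-ext (λ { (x ∷ []) → refl }) (comp₁ unpair₁ᵖ predᵖ)

tlᵖ : Computable 1 (uncurry₁ tl)
tlᵖ = computable-ext (λ { (x ∷ []) → refl }) (comp₁ unpair₂ᵖ predᵖ)

hd-cons : ∀ x l → hd (cons x l) ≡ x
hd-cons = unpair₁-pair

tl-cons : ∀ x l → tl (cons x l) ≡ l
tl-cons = unpair₂-pair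

tails : ℕ → ℕ → ℕ
tails zero l = l
tails (suc j) l = tails j (tl l)

tails-tl : ∀ j l → tails j (tl l) ≡ tl (tails j l)
tails-tl zero l = refl
tails-tl (suc j) l = tails-tl j (tl l)

tailsᵖ : Computable 2 (uncurry₂ tails)
tailsᵖ = recᵖ π0 (comp₁ tlᵖ π1) (uncurry₂ tails) (λ { (l ∷ []) → refl }) (λ { j (l ∷ []) → tails-tl j l })

tails-0 : ∀ j → tails j 0 ≡ 0
tails-0 zero = refl
tails-0 (suc j) = tails-0 j

tails-+ : ∀ a b l → tails (a + b) l ≡ tails b (tails a l)
tails-+ zero b l = refl
tails-+ (suc a) b l = tails-+ a b (tl l)

el : ℕ → ℕ → ℕ
el l j = hd (tails j l)

elᵖ : Computable 2 (uncurry₂ el)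
elᵖ = computable-ext (λ { (l ∷ j ∷ []) → refl }) (comp₁ hdᵖ (comp₂ tailsᵖ π1 π0))

prefix-cong : ∀ {f g : ℕ → ℕ} n → (∀ i → i < n → f i ≡ g i) → prefix f n ≡ prefix g n
prefix-cong zero e = refl
prefix-cong (suc n) e = cong₂ _∷_ (e 0 (s≤s z≤n)) (prefix-cong n (λ i lt → e (suc i) (s≤s lt)))

tails-prefix : ∀ j N (g : ℕ → ℕ) → j ≤ N → tails j ⌜ prefix g N ⌝ ≡ ⌜ prefix (λ i → g (j + i)) (N ∸ j) ⌝
tails-prefix zero N g _ = refl
tails-prefix (suc j) (suc N) g (s≤s le) rewrite tl-cons (g 0) ⌜ prefix (λ i → g (suc i)) N ⌝ =
  tails-prefix j N (λ i → g (suc i)) le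

tails-beyond : ∀ j N (g : ℕ → ℕ) → N ≤ j → tails j ⌜ prefix g N ⌝ ≡ 0
tails-beyond j N g N≤j = begin
  tails j ⌜ prefix g N ⌝                               ≡⟨ cong (λ z → tails z ⌜ prefix g N ⌝) (sym (m+[n∸m]≡n N≤j)) ⟩
  tails (N + (j ∸ N)) ⌜ prefix g N ⌝                   ≡⟨ tails-+ N (j ∸ N) _ ⟩
  tails (j ∸ N) (tails N ⌜ prefix g N ⌝)               ≡⟨ cong (tails (j ∸ N)) (tails-prefix N N g ≤-refl) ⟩
  tails (j ∸ N) ⌜ prefix (λ i → g (N + i)) (N ∸ N) ⌝   ≡⟨ cong (λ z → tails (j ∸ N) ⌜ prefix (λ i → g (N + i)) z ⌝)
                                                               (n∸n≡0 N) ⟩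
  tails (j ∸ N) 0                                      ≡⟨ tails-0 (j ∸ N) ⟩
  0                                                    ∎
  where open ≡-Reasoning

tails-within : ∀ j N (g : ℕ → ℕ) → j < N → Σ ℕ λ r → tails j ⌜ prefix g N ⌝ ≡ cons (g j) r
tails-within j N g j<N with N ∸ j | m>n⇒m∸n≢0 j<N | tails-prefix j N g (<⇒≤ j<N)
... | zero  | N∸j≢0 | _ = ⊥-elim (N∸j≢0 refl)
... | suc r | _     | e = ⌜ prefix (λ i → g (j + suc i)) r ⌝ ,
  trans e (cong (λ z → cons (g z) ⌜ prefix (λ i → g (j + suc i)) r ⌝) (+-identityʳ j))

el-prefix : ∀ j N (g : ℕ → ℕ) → j < N → el ⌜ prefix g N ⌝ j ≡ g j
el-prefix j N g j<N with tails-within j N g j<N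
... | r , e rewrite e = hd-cons (g j) r

length≤code : ∀ (g : ℕ → ℕ) N → N ≤ ⌜ prefix g N ⌝
length≤code g zero = z≤n
length≤code g (suc N) = s≤s (≤-trans (length≤code (λ i → g (suc i)) N)
                                     (m≤n+m _ (tri (g 0 + ⌜ prefix (λ i → g (suc i)) N ⌝))))

-- The step budget granted to an input prefix: bud l K counts up to K while the
-- coded list l still has an entry at position 2·(count) + 1, so that budget l
-- is the largest M ≤ l with 2M ≤ length of l.  Sound: the first M entries of
-- both interleaved halves of the input are available; complete: it grows
-- without bound along longer prefixes.
isnz : ℕ → ℕ
isnz zero = 0
isnz (suc _) = 1

isnzᵖ : Computable 1 (uncurry₁ isnz)
isnzᵖ = computable-ext (λ { (zero ∷ []) → refl ; (suc x ∷ []) → refl })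
          (comp₃ ifnzᵖ π0 (constᵖ 1) (constᵖ 0))

bud : ℕ → ℕ → ℕ
bud l zero = 0
bud l (suc K) = bud l K + isnz (tails (suc (2 * bud l K)) l)

budget : ℕ → ℕ
budget l = bud l l

budgetᵖ : Computable 1 (uncurry₁ budget)
budgetᵖ = computable-ext (λ { (l ∷ []) → refl }) (comp₂ budᵖ π0 π0)
  where
  budᵖ : Computable 2 (uncurry₂ (λ K l → bud l K))
  budᵖ = recᵖ zeroᵖ (comp₂ addᵖ π1 (comp₁ isnzᵖ (comp₂ tailsᵖ (comp₁ sucᵖ (comp₂ mulᵖ (constᵖ 2) π1)) π2)))
           _ (λ { (l ∷ []) → refl }) (λ { K (l ∷ []) → refl })

bud≤bound : ∀ l K → bud l K ≤ K
bud≤bound l zero = z≤n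
bud≤bound l (suc K) with tails (suc (2 * bud l K)) l
... | zero  = ≤-trans (≤-reflexive (+-identityʳ _)) (m≤n⇒m≤1+n (bud≤bound l K))
... | suc _ = ≤-trans (≤-reflexive (+-comm _ 1)) (s≤s (bud≤bound l K))

2*suc : ∀ j → 2 * suc j ≡ suc (suc (2 * j))
2*suc j = cong suc (+-suc j (j + 0))

bud-sound : ∀ (g : ℕ → ℕ) N K → 2 * bud ⌜ prefix g N ⌝ K ≤ N
bud-sound g N zero = z≤n
bud-sound g N (suc K) with suc (2 * bud ⌜ prefix g N ⌝ K) <? N
... | yes lt with tails-within _ N g lt
...   | r , e rewrite e | +-comm (bud ⌜ prefix g N ⌝ K) 1 | 2*suc (bud ⌜ prefix g N ⌝ K) = lt
bud-sound g N (suc K) | no nlt rewrite tails-beyond _ N g (≮⇒≥ nlt) | +-identityʳ (bud ⌜ prefix g N ⌝ K) =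
  bud-sound g N K

bud-complete : ∀ (g : ℕ → ℕ) N K T → T ≤ K → 2 * T ≤ N → T ≤ bud ⌜ prefix g N ⌝ K
bud-complete g N K zero _ _ = z≤n
bud-complete g N (suc K) (suc T) (s≤s T≤K) 2T≤N with m≤n⇒m<n∨m≡n T≤K
... | inj₁ T<K = ≤-trans (bud-complete g N K (suc T) T<K 2T≤N) (m≤m+n _ _)
... | inj₂ refl with ≤-antisym (bud≤bound ⌜ prefix g N ⌝ T)
                       (bud-complete g N T T ≤-refl (≤-trans (*-monoʳ-≤ 2 (n≤1+n T)) 2T≤N))
...   | eq with tails-within (suc (2 * bud ⌜ prefix g N ⌝ T)) N g
                 (subst (λ z → suc (2 * z) < N) (sym eq) (subst (_≤ N) (2*suc T) 2T≤N))
...     | r , e rewrite e | eq = ≤-reflexive (+-comm 1 T)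

budget-sound : ∀ (g : ℕ → ℕ) N → 2 * budget ⌜ prefix g N ⌝ ≤ N
budget-sound g N = bud-sound g N ⌜ prefix g N ⌝

budget-complete : ∀ (g : ℕ → ℕ) T → T ≤ budget ⌜ prefix g (2 * T) ⌝
budget-complete g T = bud-complete g (2 * T) _ T
  (≤-trans (m≤m+n T (T + 0)) (length≤code g (2 * T))) ≤-refl

select-all : ∀ {n m} (σ : Fin n → Fin m) → AllComputable {m} (tabulate (λ i xs → lookup xs (σ i)))
select-all {zero} σ = []ᵖ
select-all {suc n} σ = projᵖ (σ fz) ∷ᵖ select-all (λ i → σ (fs i))

map-select : ∀ {n m} (σ : Fin n → Fin m) (xs : Vec ℕ m) →
  map (λ g → g xs) (tabulate (λ i (ys : Vec ℕ m) → lookup ys (σ i))) ≡ tabulate (λ i → lookup xs (σ i))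
map-select {zero} σ xs = refl
map-select {suc n} σ xs = cong (lookup xs (σ fz) ∷_) (map-select (λ i → σ (fs i)) xs)

select-suffix : ∀ {n m} (σ : Fin n → Fin m) (ys : Vec ℕ m) (xs : Vec ℕ n) → (∀ i → lookup ys (σ i) ≡ lookup xs i) →
                map (λ g → g ys) (tabulate (λ i zs → lookup zs (σ i))) ≡ xs
select-suffix σ ys xs same = trans (map-select σ ys) (trans (tabulate-cong same) (tabulate∘lookup xs))

substᵖ : ∀ {n m} {E : Vec ℕ (suc n) → ℕ} {h : Vec ℕ m → ℕ} → Computable (suc n) E → Computable m h →
         (σ : Fin n → Fin m) → Computable m (λ xs → E (h xs ∷ tabulate (λ i → lookup xs (σ i))))
substᵖ {E = E} {h} pE ph σ =
  computable-ext (λ xs → cong (λ w → E (h xs ∷ w)) (map-select σ xs)) (compᵖ pE (ph ∷ᵖ select-all σ))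

ignore₂ᵖ : ∀ {n} {v : Vec ℕ (suc n) → ℕ} → Computable (suc n) v →
           Computable (suc (suc n)) (λ { (k ∷ _ ∷ ps) → v (k ∷ ps) })
ignore₂ᵖ {v = v} pv = computable-ext (λ { (k ∷ z ∷ ps) → cong (λ w → v (k ∷ w)) (tabulate∘lookup ps) })
  (substᵖ pv π0 (λ i → fs (fs i)))

firstNZ : (ℕ → ℕ) → ℕ → ℕ
firstNZ v zero = 0
firstNZ v (suc M) = ifnz (firstNZ v M) (firstNZ v M) (v M)

firstNZᵖ : ∀ {n} {v : Vec ℕ (suc n) → ℕ} → Computable (suc n) v →
           Computable (suc n) (λ { (M ∷ ps) → firstNZ (λ t → v (t ∷ ps)) M })
firstNZᵖ pv = recᵖ zeroᵖ (comp₃ ifnzᵖ π1 π1 (ignore₂ᵖ pv)) _ (λ ps → refl) (λ k ps → refl)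

firstNZ-sound : ∀ v M y → firstNZ v M ≡ suc y →
  Σ ℕ λ t → t < M × v t ≡ suc y × (∀ t' → t' < t → v t' ≡ 0)
firstNZ-sound v (suc M) y e with firstNZ v M in eq
... | suc z with firstNZ-sound v M y (trans eq e)
...   | t , lt , vt , before = t , m≤n⇒m≤1+n lt , vt , before
firstNZ-sound v (suc M) y e | zero = M , ≤-refl , e , earlier-zero M eq
  where
  earlier-zero : ∀ M → firstNZ v M ≡ 0 → ∀ t' → t' < M → v t' ≡ 0
  earlier-zero (suc M) e t' lt with firstNZ v M in eq'
  ... | zero with m≤n⇒m<n∨m≡n (≤-pred lt)
  ...   | inj₁ lt'  = earlier-zero M eq' t' lt'
  ...   | inj₂ refl = e

firstNZ-zero : ∀ v M → (∀ t → t < M → v t ≡ 0) → firstNZ v M ≡ 0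
firstNZ-zero v zero h = refl
firstNZ-zero v (suc M) h rewrite firstNZ-zero v M (λ t lt → h t (m≤n⇒m≤1+n lt)) = h M ≤-refl

firstNZ-complete : ∀ v M t y → t < M → v t ≡ suc y → (∀ t' → t' < t → v t' ≡ 0) → firstNZ v M ≡ suc y
firstNZ-complete v (suc M) t y lt vt before with m≤n⇒m<n∨m≡n (≤-pred lt)
... | inj₁ lt' rewrite firstNZ-complete v M t y lt' vt before = refl
... | inj₂ refl rewrite firstNZ-zero v M before = vt

firstNZ-nonzero : ∀ v M t → t < M → v t ≢ 0 → firstNZ v M ≢ 0
firstNZ-nonzero v (suc M) t lt vt with firstNZ v M in eq
... | suc _ = λ ()
... | zero with m≤n⇒m<n∨m≡n (≤-pred lt)
...   | inj₁ lt'  = λ _ → firstNZ-nonzero v M t lt' vt eq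
...   | inj₂ refl = vt

merge-even : ∀ j (p q : Baire) → merge p q (2 * j) ≡ p j
merge-even zero p q = refl
merge-even (suc j) p q rewrite 2*suc j = merge-even j (λ i → p (suc i)) (λ i → q (suc i))

merge-odd : ∀ j (p q : Baire) → merge p q (suc (2 * j)) ≡ q j
merge-odd zero p q = refl
merge-odd (suc j) p q rewrite +-suc j (j + 0) = merge-odd j (λ i → p (suc i)) (λ i → q (suc i))

-- Coding a prefix of a computable sequence: prefixFrom E t j codes
-- E (t ∸ j), …, E (t ∸ 1), and prefixCode E t codes E 0, …, E (t-1).
prefixFrom : (ℕ → ℕ) → ℕ → ℕ → ℕ
prefixFrom E t zero = 0
prefixFrom E t (suc j) = cons (E (t ∸ suc j)) (prefixFrom E t j)

prefixFrom-correct : ∀ E t j → j ≤ t → prefixFrom E t j ≡ ⌜ prefix (λ i → E (t ∸ j + i)) j ⌝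
prefixFrom-correct E t zero _ = refl
prefixFrom-correct E t (suc j) j<t rewrite prefixFrom-correct E t j (≤-trans (n≤1+n j) j<t) =
  cong suc (cong₂ pair (cong E (sym (+-identityʳ (t ∸ suc j))))
    (cong ⌜_⌝ (prefix-cong j (λ i _ → cong E (shift i)))))
  where
  shift : ∀ i → t ∸ j + i ≡ t ∸ suc j + suc i
  shift i = begin
    t ∸ j + i             ≡⟨ cong (_+ i) (+-∸-assoc 1 j<t) ⟩
    suc (t ∸ suc j) + i   ≡⟨ sym (+-suc (t ∸ suc j) i) ⟩
    t ∸ suc j + suc i     ∎
    where open ≡-Reasoning

prefixCode : (ℕ → ℕ) → ℕ → ℕ
prefixCode E t = prefixFrom E t t

prefixCode-correct : ∀ E t → prefixCode E t ≡ ⌜ prefix E t ⌝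
prefixCode-correct E t = trans (prefixFrom-correct E t t ≤-refl)
  (cong ⌜_⌝ (prefix-cong t (λ i _ → cong E (cong (_+ i) (n∸n≡0 t)))))

prefixCodeᵖ : ∀ {n} {E : Vec ℕ (suc n) → ℕ} → Computable (suc n) E →
              Computable (suc n) (λ { (t ∷ ps) → prefixCode (λ i → E (i ∷ ps)) t })
prefixCodeᵖ {n} {E} pE = computable-ext
  (λ { (t ∷ ps) → cong (λ w → prefixFrom (λ i → E (i ∷ w)) t t) (select-suffix fs (t ∷ ps) ps (λ _ → refl)) })
  (compᵖ prefixFromᵖ (π0 ∷ᵖ π0 ∷ᵖ select-all fs))
  where
  step : Vec ℕ (suc (suc (suc n))) → ℕ
  step (k ∷ _ ∷ t ∷ ps) = E ((t ∸ suc k) ∷ ps)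
  stepᵖ : Computable (suc (suc (suc n))) step
  stepᵖ = computable-ext (λ { (k ∷ z ∷ t ∷ ps) → cong (λ w → E ((t ∸ suc k) ∷ w)) (tabulate∘lookup ps) })
            (substᵖ pE (comp₂ monusᵖ π2 (comp₁ sucᵖ π0)) (λ i → fs (fs (fs i))))
  prefixFromᵖ : Computable (suc (suc n)) (λ { (j ∷ t ∷ ps) → prefixFrom (λ i → E (i ∷ ps)) t j })
  prefixFromᵖ = recᵖ zeroᵖ (comp₂ consᵖ stepᵖ π1) _ (λ { (t ∷ ps) → refl }) (λ { k (t ∷ ps) → refl })

-- The code of the constant list m, …, m of length t (a prefix of the name λ _ → m of m).
constCode : ℕ → ℕ → ℕ
constCode m zero = 0
constCode m (suc t) = cons m (constCode m t)

constCode-correct : ∀ m t → constCode m t ≡ ⌜ prefix (λ _ → m) t ⌝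
constCode-correct m zero = refl
constCode-correct m (suc t) = cong (cons m) (constCode-correct m t)

constCodeᵖ : Computable 2 (uncurry₂ (λ t m → constCode m t))
constCodeᵖ = recᵖ zeroᵖ (comp₂ consᵖ π2 π1) _ (λ { (m ∷ []) → refl }) (λ { k (m ∷ []) → refl })

-- A step-bounded interpreter for codes.  run c s xs is 0 if the evaluation of c
-- at xs does not finish when every unbounded search is cut off after s
-- candidates, and suc y if it finishes with value y.  It is sound
-- (run-sound), eventually complete (run-complete) and computable (runᵖ); this
-- is what turns the computably enumerable relation R into a total test.
allnz : ∀ {m} → Vec ℕ m → ℕ
allnz [] = 1
allnz (v ∷ vs) = ifnz v (allnz vs) 0

runPrec : ∀ {n} → (Vec ℕ n → ℕ) → (Vec ℕ (suc (suc n)) → ℕ) → ℕ → Vec ℕ n → ℕ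
runPrec F G zero xs = F xs
runPrec F G (suc k) xs = ifnz (runPrec F G k xs) (G (k ∷ pred (runPrec F G k xs) ∷ xs)) 0

-- The state of a bounded minimisation: 0 while all candidates so far returned a
-- nonzero value, 1 once some candidate diverged (within the bound), and
-- suc (suc i) once candidate i returned 0.
muStep : ℕ → ℕ → ℕ
muStep v i = ifnz v (ifnz (pred v) 0 (suc (suc i))) 1

muSearch : (ℕ → ℕ) → ℕ → ℕ
muSearch V zero = 0
muSearch V (suc i) = ifnz (muSearch V i) (muSearch V i) (muStep (V i) i)

muResult : ℕ → ℕ
muResult st = ifnz (pred st) (pred st) 0

mutual
  run : ∀ {n} → Code n → ℕ → Vec ℕ n → ℕ
  run zer s xs = 1
  run succ s (x ∷ []) = suc (suc x)
  run (proj i) s xs = suc (lookup xs i)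
  run (comp f gs) s xs = ifnz (allnz (runs gs s xs)) (run f s (map pred (runs gs s xs))) 0
  run (prec f g) s (k ∷ xs) = runPrec (run f s) (run g s) k xs
  run (mu f) s xs = muResult (muSearch (λ i → run f s (i ∷ xs)) s)

  runs : ∀ {m n} → Vec (Code n) m → ℕ → Vec ℕ n → Vec ℕ m
  runs [] s xs = []
  runs (g ∷ gs) s xs = run g s xs ∷ runs gs s xs

Run : ∀ {n} → Code n → Vec ℕ (suc n) → ℕ
Run c (s ∷ xs) = run c s xs

muResult-inv : ∀ {st y} → muResult st ≡ suc y → st ≡ suc (suc y)
muResult-inv {suc (suc z)} refl = refl

muSearch-zero : ∀ V s → muSearch V s ≡ 0 → ∀ j → j < s → ∃ λ v → V j ≡ suc (suc v)
muSearch-zero V (suc s) e j lt with muSearch V s in eq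
... | zero with m≤n⇒m<n∨m≡n (≤-pred lt)
...   | inj₁ lt' = muSearch-zero V s eq j lt'
...   | inj₂ refl with V j
...     | suc (suc v) = v , refl

muSearch-sound : ∀ V s y → muSearch V s ≡ suc (suc y) →
                 y < s × V y ≡ 1 × (∀ j → j < y → ∃ λ v → V j ≡ suc (suc v))
muSearch-sound V (suc s) y e with muSearch V s in eq
... | suc z with muSearch-sound V s y (trans eq e)
...   | lt , a , b = m≤n⇒m≤1+n lt , a , b
muSearch-sound V (suc s) y e | zero with V s in eqv
muSearch-sound V (suc s) y refl | zero | suc zero = ≤-refl , eqv , muSearch-zero V s eq

mutual
  run-sound : ∀ {n} (c : Code n) s xs y → run c s xs ≡ suc y → Eval c xs y
  run-sound zer s xs y refl = ev-zer
  run-sound succ s (x ∷ []) y refl = ev-succ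
  run-sound (proj i) s xs y refl = ev-proj i
  run-sound (comp f gs) s xs y e with allnz (runs gs s xs) in eq
  ... | suc _ = ev-comp (runs-sound gs s xs (subst (_≢ 0) (sym eq) (λ ()))) (run-sound f s _ y e)
  run-sound (prec f g) s (k ∷ xs) y e = prec-sound f g s k xs y e
  run-sound (mu f) s xs y e with muSearch-sound (λ i → run f s (i ∷ xs)) s y (muResult-inv e)
  ... | _ , vy , before = ev-mu (run-sound f s (y ∷ xs) 0 vy)
        (λ i lt → let (v , ev) = before i lt in v , run-sound f s (i ∷ xs) (suc v) ev)

  runs-sound : ∀ {m n} (gs : Vec (Code n) m) s xs → allnz (runs gs s xs) ≢ 0 →
               EvalVec gs xs (map pred (runs gs s xs))
  runs-sound [] s xs h = evv-[]
  runs-sound (g ∷ gs) s xs h with run g s xs in eq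
  ... | zero = ⊥-elim (h refl)
  ... | suc v = evv-∷ (run-sound g s xs v eq) (runs-sound gs s xs h)

  prec-sound : ∀ {n} (f : Code n) g s k xs y → runPrec (run f s) (run g s) k xs ≡ suc y →
               Eval (prec f g) (k ∷ xs) y
  prec-sound f g s zero xs y e = ev-prec0 (run-sound f s xs y e)
  prec-sound f g s (suc k) xs y e with runPrec (run f s) (run g s) k xs in eq
  ... | suc v = ev-precS (prec-sound f g s k xs v eq) (run-sound g s _ y e)

Eventually : (ℕ → Set) → Set
Eventually P = Σ ℕ λ s₀ → ∀ s → s₀ ≤ s → P s

eventually-map : ∀ {P Q : ℕ → Set} → (∀ {s} → P s → Q s) → Eventually P → Eventually Q
eventually-map f (s₀ , k) = s₀ , λ s le → f (k s le)

eventually-both : ∀ {P Q : ℕ → Set} → Eventually P → Eventually Q → Eventually (λ s → P s × Q s)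
eventually-both (s₁ , k₁) (s₂ , k₂) =
  s₁ ⊔ s₂ , λ s le → k₁ s (≤-trans (m≤m⊔n s₁ s₂) le) , k₂ s (≤-trans (m≤n⊔m s₁ s₂) le)

eventually-above : ∀ n → Eventually (n ≤_)
eventually-above n = n , λ s le → le

eventually-all : ∀ y (P : ℕ → ℕ → Set) → (∀ i → i < y → Eventually (P i)) →
                 Eventually (λ s → ∀ i → i < y → P i s)
eventually-all zero P h = 0 , λ s _ i ()
eventually-all (suc y) P h =
  eventually-map combine (eventually-both (eventually-all y P (λ i lt → h i (m≤n⇒m≤1+n lt))) (h y ≤-refl))
  where
  combine : ∀ {s} → (∀ i → i < y → P i s) × P y s → ∀ i → i < suc y → P i s
  combine (below , at) i lt with m≤n⇒m<n∨m≡n (≤-pred lt)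
  ... | inj₁ lt'  = below i lt'
  ... | inj₂ refl = at

muSearch-before : ∀ V y → (∀ j → j < y → ∃ λ v → V j ≡ suc (suc v)) → ∀ i → i ≤ y → muSearch V i ≡ 0
muSearch-before V y h zero _ = refl
muSearch-before V y h (suc i) le rewrite muSearch-before V y h i (≤-trans (n≤1+n i) le) with h i le
... | v , e rewrite e = refl

muSearch-finds : ∀ V y → V y ≡ 1 → (∀ j → j < y → ∃ λ v → V j ≡ suc (suc v)) →
                 ∀ s → y < s → muSearch V s ≡ suc (suc y)
muSearch-finds V y vy h (suc s) (s≤s le) with m≤n⇒m<n∨m≡n le
... | inj₁ lt rewrite muSearch-finds V y vy h s lt = refl
... | inj₂ refl rewrite muSearch-before V y h y ≤-refl | vy = refl

allnz-suc : ∀ {m} (ys : Vec ℕ m) → allnz (map suc ys) ≡ 1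
allnz-suc [] = refl
allnz-suc (y ∷ ys) = allnz-suc ys

pred-suc : ∀ {m} (ys : Vec ℕ m) → map pred (map suc ys) ≡ ys
pred-suc [] = refl
pred-suc (y ∷ ys) = cong (y ∷_) (pred-suc ys)

mutual
  run-complete : ∀ {n} {c : Code n} {xs y} → Eval c xs y → Eventually (λ s → run c s xs ≡ suc y)
  run-complete ev-zer = 0 , λ s _ → refl
  run-complete ev-succ = 0 , λ s _ → refl
  run-complete (ev-proj i) = 0 , λ s _ → refl
  run-complete {c = comp f gs} {xs} {y} (ev-comp {ys = ys} evv evf) =
    eventually-map done (eventually-both (runs-complete evv) (run-complete evf))
    where
    done : ∀ {s} → runs gs s xs ≡ map suc ys × run f s ys ≡ suc y → run (comp f gs) s xs ≡ suc y
    done {s} (args , body) = begin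
      run (comp f gs) s xs                                          ≡⟨ cong (λ w → ifnz (allnz w) (run f s (map pred w)) 0) args ⟩
      ifnz (allnz (map suc ys)) (run f s (map pred (map suc ys))) 0 ≡⟨ cong₂ (λ a b → ifnz a (run f s b) 0)
                                                                              (allnz-suc ys) (pred-suc ys) ⟩
      run f s ys                                                    ≡⟨ body ⟩
      suc y                                                         ∎
      where open ≡-Reasoning
  run-complete (ev-prec0 ef) = run-complete ef
  run-complete {c = prec f g} {_ ∷ xs} (ev-precS {k = k} ep eg) =
    eventually-map (λ (previous , step) → trans (cong (λ w → ifnz w (run g _ (k ∷ pred w ∷ xs)) 0) previous) step)
      (eventually-both (run-complete ep) (run-complete eg))
  run-complete {c = mu f} {xs} (ev-mu {y = y} e0 h) =
    eventually-map (λ (y<s , (found , before)) → cong muResult (muSearch-finds _ y found before _ y<s))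
      (eventually-both (eventually-above (suc y)) (eventually-both (run-complete e0) smaller))
    where
    smaller : Eventually (λ s → ∀ i → i < y → ∃ λ v → run f s (i ∷ xs) ≡ suc (suc v))
    smaller = eventually-all y _ (λ i lt → let (v , ev) = h i lt in eventually-map (v ,_) (run-complete ev))

  runs-complete : ∀ {m n} {gs : Vec (Code n) m} {xs ys} → EvalVec gs xs ys →
                  Eventually (λ s → runs gs s xs ≡ map suc ys)
  runs-complete evv-[] = 0 , λ s _ → refl
  runs-complete (evv-∷ e es) = eventually-map (λ (h , t) → cong₂ _∷_ h t) (eventually-both (run-complete e) (runs-complete es))

muStepᵖ : Computable 2 (uncurry₂ muStep)
muStepᵖ = computable-ext (λ { (v ∷ i ∷ []) → refl })
  (comp₃ ifnzᵖ π0 (comp₃ ifnzᵖ (comp₁ predᵖ π0) (constᵖ 0) (comp₁ sucᵖ (comp₁ sucᵖ π1))) (constᵖ 1))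

muResultᵖ : Computable 1 (uncurry₁ muResult)
muResultᵖ = computable-ext (λ { (v ∷ []) → refl }) (comp₃ ifnzᵖ (comp₁ predᵖ π0) (comp₁ predᵖ π0) (constᵖ 0))

predRuns : ∀ {m n} → Vec (Code n) m → Vec (Vec ℕ (suc n) → ℕ) m
predRuns [] = []
predRuns (g ∷ gs) = (λ v → pred (Run g v)) ∷ predRuns gs

map-predRuns : ∀ {m n} (gs : Vec (Code n) m) s xs → map (λ h → h (s ∷ xs)) (predRuns gs) ≡ map pred (runs gs s xs)
map-predRuns [] s xs = refl
map-predRuns (g ∷ gs) s xs = cong (pred (run g s xs) ∷_) (map-predRuns gs s xs)

AllNZ : ∀ {m n} → Vec (Code n) m → Vec ℕ (suc n) → ℕ
AllNZ gs (s ∷ xs) = allnz (runs gs s xs)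

PrecRun : ∀ {n} → Code n → Code (suc (suc n)) → Vec ℕ (suc (suc n)) → ℕ
PrecRun f g (k ∷ s ∷ xs) = runPrec (run f s) (run g s) k xs

PrecStep : ∀ {n} → Code (suc (suc n)) → Vec ℕ (suc (suc (suc n))) → ℕ
PrecStep g (k ∷ prev ∷ s ∷ xs) = ifnz prev (run g s (k ∷ pred prev ∷ xs)) 0

MuRun : ∀ {n} → Code (suc n) → Vec ℕ (suc (suc n)) → ℕ
MuRun f (i ∷ s ∷ xs) = muSearch (λ i → run f s (i ∷ xs)) i

MuStep : ∀ {n} → Code (suc n) → Vec ℕ (suc (suc (suc n))) → ℕ
MuStep f (i ∷ prev ∷ s ∷ xs) = ifnz prev prev (muStep (run f s (i ∷ xs)) i)

mutual
  runᵖ : ∀ {n} (c : Code n) → Computable (suc n) (Run c)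
  runᵖ zer = computable-ext (λ { (s ∷ xs) → refl }) (constᵖ 1)
  runᵖ succ = computable-ext (λ { (s ∷ x ∷ []) → refl }) (comp₁ sucᵖ (comp₁ sucᵖ π1))
  runᵖ (proj i) = computable-ext (λ { (s ∷ xs) → refl }) (comp₁ sucᵖ (projᵖ (fs i)))
  runᵖ (comp f gs) = computable-ext (λ { (s ∷ xs) → refl })
    (comp₃ ifnzᵖ (allnzᵖ gs)
      (computable-ext {g = λ { (s ∷ xs) → run f s (map pred (runs gs s xs)) }}
         (λ { (s ∷ xs) → cong (run f s) (map-predRuns gs s xs) })
         (compᵖ (runᵖ f) (π0 ∷ᵖ predRunsᵖ gs)))
      (constᵖ 0))
  runᵖ {suc n} (prec f g) = computable-ext {g = Run (prec f g)}
    (λ { (s ∷ k ∷ xs) → cong (λ w → PrecRun f g (k ∷ s ∷ w))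
                               (select-suffix (λ i → fs (fs i)) (s ∷ k ∷ xs) xs (λ _ → refl)) })
    (compᵖ recursionᵖ (π1 ∷ᵖ π0 ∷ᵖ select-all (λ i → fs (fs i))))
    where
    stepᵖ : Computable (suc (suc (suc n))) (PrecStep g)
    stepᵖ = computable-ext
      (λ { (k ∷ prev ∷ s ∷ xs) → cong (λ w → ifnz prev (run g s (k ∷ pred prev ∷ w)) 0)
                                   (select-suffix (λ i → fs (fs (fs i))) (k ∷ prev ∷ s ∷ xs) xs (λ _ → refl)) })
      (comp₃ ifnzᵖ π1 (compᵖ (runᵖ g) (π2 ∷ᵖ π0 ∷ᵖ comp₁ predᵖ π1 ∷ᵖ select-all (λ i → fs (fs (fs i)))))
                      (constᵖ 0))
    recursionᵖ : Computable (suc (suc n)) (PrecRun f g)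
    recursionᵖ = recᵖ (runᵖ f) stepᵖ (PrecRun f g) (λ { (s ∷ xs) → refl }) (λ { k (s ∷ xs) → refl })
  runᵖ {n} (mu f) = computable-ext {g = Run (mu f)}
    (λ { (s ∷ xs) → cong (λ w → muResult (MuRun f (s ∷ s ∷ w))) (select-suffix fs (s ∷ xs) xs (λ _ → refl)) })
    (comp₁ muResultᵖ (compᵖ searchᵖ (π0 ∷ᵖ π0 ∷ᵖ select-all fs)))
    where
    stepᵖ : Computable (suc (suc (suc n))) (MuStep f)
    stepᵖ = computable-ext
      (λ { (i ∷ prev ∷ s ∷ xs) → cong (λ w → ifnz prev prev (muStep (run f s (i ∷ w)) i))
                                   (select-suffix (λ i → fs (fs (fs i))) (i ∷ prev ∷ s ∷ xs) xs (λ _ → refl)) })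
      (comp₃ ifnzᵖ π1 π1 (comp₂ muStepᵖ (compᵖ (runᵖ f) (π2 ∷ᵖ π0 ∷ᵖ select-all (λ i → fs (fs (fs i))))) π0))
    searchᵖ : Computable (suc (suc n)) (MuRun f)
    searchᵖ = recᵖ zeroᵖ stepᵖ (MuRun f) (λ { (s ∷ xs) → refl }) (λ { k (s ∷ xs) → refl })

  allnzᵖ : ∀ {m n} (gs : Vec (Code n) m) → Computable (suc n) (AllNZ gs)
  allnzᵖ [] = computable-ext (λ { (s ∷ xs) → refl }) (constᵖ 1)
  allnzᵖ (g ∷ gs) = computable-ext (λ { (s ∷ xs) → refl }) (comp₃ ifnzᵖ (runᵖ g) (allnzᵖ gs) (constᵖ 0))

  predRunsᵖ : ∀ {m n} (gs : Vec (Code n) m) → AllComputable {suc n} (predRuns gs)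
  predRunsᵖ [] = []ᵖ
  predRunsᵖ (g ∷ gs) = computable-ext (λ { (s ∷ xs) → refl }) (comp₁ predᵖ (runᵖ g)) ∷ᵖ predRunsᵖ gs

-- Let a be an associate of a
-- sequence of names (such as the one of (Uₙ) or (Bₙ)); on the constant name
-- λ _ → m of m it produces a name r' of the m-th set, which is again an
-- associate, mapping names p of points (or of opens) to Sierpiński names.
-- With budget M:
--   entry a m M c       approximates r' c (0: undetermined within M steps);
--   digit a m M l E i   approximates digit i of F_r'(p), where the prefix
--                       of p of length t is read off l as prefixCode (E l) t;
--   accepts a m M l E   is nonzero iff one of the first M digits is nonzero.

-- How a simulated entry steers the search for the digit: an undetermined entry
-- (0) aborts the search with the value 1, an entry "continue" (1) is skipped,
-- and an entry suc (suc z), i.e. digit z, is kept.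
verdict : ℕ → ℕ
verdict zero = 1
verdict (suc zero) = 0
verdict (suc (suc z)) = suc (suc z)

atLeast2 : ℕ → ℕ
atLeast2 (suc (suc z)) = 1
atLeast2 _ = 0

verdictᵖ : Computable 1 (uncurry₁ verdict)
verdictᵖ = computable-ext (λ { (zero ∷ []) → refl ; (suc zero ∷ []) → refl ; (suc (suc z) ∷ []) → refl })
  (comp₃ ifnzᵖ π0 (comp₃ ifnzᵖ (comp₁ predᵖ π0) π0 (constᵖ 0)) (constᵖ 1))

atLeast2ᵖ : Computable 1 (uncurry₁ atLeast2)
atLeast2ᵖ = computable-ext (λ { (zero ∷ []) → refl ; (suc zero ∷ []) → refl ; (suc (suc z) ∷ []) → refl })
  (comp₃ ifnzᵖ (comp₁ predᵖ π0) (constᵖ 1) (constᵖ 0))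

entry : (ℕ → ℕ) → ℕ → ℕ → ℕ → ℕ
entry a m M c = firstNZ (λ t → a (cons c (constCode m t))) M

digit : (ℕ → ℕ) → ℕ → ℕ → ℕ → (ℕ → ℕ → ℕ) → ℕ → ℕ
digit a m M l E i = pred (firstNZ (λ t → verdict (entry a m M (cons i (prefixCode (E l) t)))) M)

accepts : (ℕ → ℕ) → ℕ → ℕ → ℕ → (ℕ → ℕ → ℕ) → ℕ
accepts a m M l E = firstNZ (λ i → atLeast2 (digit a m M l E i)) M

module _ {a : ℕ → ℕ} (aᵖ : Computable 1 (uncurry₁ a)) where

  entryᵖ : Computable 3 (λ { (M ∷ m ∷ c ∷ []) → entry a m M c })
  entryᵖ = computable-ext (λ { (M ∷ m ∷ c ∷ []) → refl })
    (firstNZᵖ {v = λ { (t ∷ m ∷ c ∷ []) → a (cons c (constCode m t)) }}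
      (computable-ext (λ { (t ∷ m ∷ c ∷ []) → refl }) (comp₁ aᵖ (comp₂ consᵖ π2 (comp₂ constCodeᵖ π0 π1)))))

  module _ {E : ℕ → ℕ → ℕ} (Eᵖ : Computable 2 (uncurry₂ (λ j l → E l j))) where

    digitᵖ : Computable 4 (λ { (M ∷ i ∷ m ∷ l ∷ []) → digit a m M l E i })
    digitᵖ = computable-ext (λ { (M ∷ i ∷ m ∷ l ∷ []) → refl })
      (comp₁ predᵖ (compᵖ
        (firstNZᵖ {v = λ { (t ∷ M ∷ i ∷ m ∷ l ∷ []) → verdict (entry a m M (cons i (prefixCode (E l) t))) }}
          (computable-ext (λ { (t ∷ M ∷ i ∷ m ∷ l ∷ []) → refl })
            (comp₁ verdictᵖ (comp₃ entryᵖ π1 π3 (comp₂ consᵖ π2 (comp₂ prefixCodeEᵖ π0 π4))))))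
        (π0 ∷ᵖ π0 ∷ᵖ π1 ∷ᵖ π2 ∷ᵖ π3 ∷ᵖ []ᵖ)))
      where
      prefixCodeEᵖ : Computable 2 (uncurry₂ (λ t l → prefixCode (E l) t))
      prefixCodeEᵖ = computable-ext (λ { (t ∷ l ∷ []) → refl }) (prefixCodeᵖ Eᵖ)

    acceptsᵖ : Computable 3 (λ { (M ∷ m ∷ l ∷ []) → accepts a m M l E })
    acceptsᵖ = computable-ext (λ { (M ∷ m ∷ l ∷ []) → refl })
      (compᵖ
        (firstNZᵖ {v = λ { (i ∷ M ∷ m ∷ l ∷ []) → atLeast2 (digit a m M l E i) }}
          (computable-ext (λ { (i ∷ M ∷ m ∷ l ∷ []) → refl })
            (comp₁ atLeast2ᵖ (compᵖ digitᵖ (π1 ∷ᵖ π0 ∷ᵖ π2 ∷ᵖ π3 ∷ᵖ []ᵖ)))))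
        (π0 ∷ᵖ π0 ∷ᵖ π1 ∷ᵖ π2 ∷ᵖ []ᵖ))

assocVal-unique : ∀ {h p k y y'} → AssocVal h p k y → AssocVal h p k y' → y ≡ y'
assocVal-unique (n , e , before) (n' , e' , before') with <-cmp n n'
... | tri< lt _ _   = ⊥-elim (0≢1+n (trans (sym (before' n lt)) e))
... | tri≈ _ refl _ = suc-injective (trans (sym e) e')
... | tri> _ _ gt   = ⊥-elim (0≢1+n (trans (sym (before n' gt)) e'))

verdict-digit : ∀ {w z} → verdict w ≡ suc (suc z) → w ≡ suc (suc z)
verdict-digit {suc (suc w)} e = e

verdict-continue : ∀ {w} → verdict w ≡ 0 → w ≡ 1
verdict-continue {suc zero} e = refl

Presents : ℕ → ℕ → (ℕ → ℕ → ℕ) → Baire → Set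
Presents M l E p = ∀ t → t ≤ M → prefixCode (E l) t ≡ ⌜ prefix p t ⌝

module Simulation (a : ℕ → ℕ) (m : ℕ) (r' : Baire) (a↦r' : AssocMap a (λ _ → m) r') where

  entry-sound : ∀ M c y → entry a m M c ≡ suc y → r' c ≡ y
  entry-sound M c y e with firstNZ-sound _ M y e
  ... | t , _ , at , before = assocVal-unique {a} {λ _ → m} {c} (a↦r' c)
    (t , trans (cong (λ w → a (cons c w)) (sym (constCode-correct m t))) at ,
     λ t' lt' → trans (cong (λ w → a (cons c w)) (sym (constCode-correct m t'))) (before t' lt'))

  entry-complete : ∀ c → Eventually (λ M → entry a m M c ≡ suc (r' c))
  entry-complete c with a↦r' c
  ... | n , at , before = suc n , λ M le → firstNZ-complete _ M n (r' c) le
    (trans (cong (λ w → a (cons c w)) (constCode-correct m n)) at)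
    (λ t' lt' → trans (cong (λ w → a (cons c w)) (constCode-correct m t')) (before t' lt'))

  digit-sound : ∀ M l E p i z → Presents M l E p → digit a m M l E i ≡ suc z → AssocVal r' p i z
  digit-sound M l E p i z presents e
    with firstNZ (λ t → verdict (entry a m M (cons i (prefixCode (E l) t)))) M in eq
  ... | suc (suc z') with e
  ...   | refl with firstNZ-sound _ M (suc z) eq
  ...     | t , lt , at , before =
    t , trans (cong (λ w → r' (cons i w)) (sym (presents t (<⇒≤ lt)))) (entry-sound M _ (suc z) (verdict-digit at)) ,
    λ t' lt' → trans (cong (λ w → r' (cons i w)) (sym (presents t' (<⇒≤ (<-trans lt' lt)))))
                     (entry-sound M _ 0 (verdict-continue (before t' lt')))

  digit-complete : ∀ p i z → AssocVal r' p i z →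
                   Eventually (λ M → ∀ l E → Presents M l E p → digit a m M l E i ≡ suc z)
  digit-complete p i z (t₀ , at , before) = eventually-map found
    (eventually-both (eventually-above (suc t₀)) (eventually-all (suc t₀) EntryKnown (λ t _ → entry-complete _)))
    where
    EntryKnown : ℕ → ℕ → Set
    EntryKnown t M = entry a m M (cons i ⌜ prefix p t ⌝) ≡ suc (r' (cons i ⌜ prefix p t ⌝))
    found : ∀ {M} → suc t₀ ≤ M × (∀ t → t < suc t₀ → EntryKnown t M) →
            ∀ l E → Presents M l E p → digit a m M l E i ≡ suc z
    found {M} (t₀<M , entries) l E presents = cong pred (firstNZ-complete _ M t₀ (suc z) t₀<M
      (cong verdict (trans (simulated t₀ ≤-refl) (cong suc at)))
      (λ t' lt' → cong verdict (trans (simulated t' (<⇒≤ lt')) (cong suc (before t' lt')))))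
      where
      simulated : ∀ t → t ≤ t₀ → entry a m M (cons i (prefixCode (E l) t)) ≡ suc (r' (cons i ⌜ prefix p t ⌝))
      simulated t t≤t₀ = trans (cong (λ w → entry a m M (cons i w)) (presents t (≤-trans t≤t₀ (≤-trans (n≤1+n t₀) t₀<M))))
                               (entries t (s≤s t≤t₀))

  accepts-sound : ∀ M l E p (r : Baire) → AssocMap r' p r → Presents M l E p →
                  accepts a m M l E ≢ 0 → ∃ λ i → r i ≢ 0
  accepts-sound M l E p r p↦r presents nz with firstNZ (λ i → atLeast2 (digit a m M l E i)) M in eq
  ... | zero = ⊥-elim (nz refl)
  ... | suc y with firstNZ-sound _ M y eq
  ...   | i , _ , at , _ with digit a m M l E i in eq'
  ...     | suc (suc z) = i , λ ri≡0 → 0≢1+n (trans (sym ri≡0)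
                                (assocVal-unique {r'} {p} {i} (p↦r i) (digit-sound M l E p i (suc z) presents eq')))

  accepts-complete : ∀ p (r : Baire) → AssocMap r' p r → (∃ λ i → r i ≢ 0) →
                     Eventually (λ M → ∀ l E → Presents M l E p → accepts a m M l E ≢ 0)
  accepts-complete p r p↦r (i , ri≢0) with r i in eq
  ... | zero = ⊥-elim (ri≢0 refl)
  ... | suc z = eventually-map accepted
      (eventually-both (eventually-above (suc i)) (digit-complete p i (suc z) (subst (AssocVal r' p i) eq (p↦r i))))
    where
    accepted : ∀ {M} → suc i ≤ M × (∀ l E → Presents M l E p → digit a m M l E i ≡ suc (suc z)) →
               ∀ l E → Presents M l E p → accepts a m M l E ≢ 0
    accepted {M} (i<M , digit-i) l E presents =
      firstNZ-nonzero _ M i i<M (λ e → 0≢1+n (trans (sym e) (cong atLeast2 (digit-i l E presents))))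

computable→baire : ∀ {h} → Computable 1 (uncurry₁ h) → ComputableBaire h
computable→baire (e , ev) = e , λ k → ev (k ∷ [])

baire→computable : ∀ {h} → ComputableBaire h → Computable 1 (uncurry₁ h)
baire→computable (e , ev) = e , λ { (k ∷ []) → ev k }

evenEntries : ℕ → ℕ → ℕ
evenEntries l j = el l (2 * j)

oddEntries : ℕ → ℕ → ℕ
oddEntries l j = el l (suc (2 * j))

evenEntriesᵖ : Computable 2 (uncurry₂ (λ j l → evenEntries l j))
evenEntriesᵖ = computable-ext (λ { (j ∷ l ∷ []) → refl }) (comp₂ elᵖ π1 (comp₂ mulᵖ (constᵖ 2) π0))

oddEntriesᵖ : Computable 2 (uncurry₂ (λ j l → oddEntries l j))
oddEntriesᵖ = computable-ext (λ { (j ∷ l ∷ []) → refl }) (comp₂ elᵖ π1 (comp₁ sucᵖ (comp₂ mulᵖ (constᵖ 2) π0)))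

presents-even : ∀ (p q : Baire) N M → 2 * M ≤ N → Presents M ⌜ prefix (merge p q) N ⌝ evenEntries p
presents-even p q N M 2M≤N t t≤M = trans (prefixCode-correct _ t) (cong ⌜_⌝ (prefix-cong t (λ j j<t →
  trans (el-prefix (2 * j) N (merge p q) (<-≤-trans (*-monoʳ-< 2 (<-≤-trans j<t t≤M)) 2M≤N))
        (merge-even j p q))))

presents-odd : ∀ (p q : Baire) N M → 2 * M ≤ N → Presents M ⌜ prefix (merge p q) N ⌝ oddEntries q
presents-odd p q N M 2M≤N t t≤M = trans (prefixCode-correct _ t) (cong ⌜_⌝ (prefix-cong t (λ j j<t →
  trans (el-prefix (suc (2 * j)) N (merge p q)
          (≤-trans (≤-reflexive (sym (2*suc j))) (≤-trans (*-monoʳ-≤ 2 (≤-trans j<t t≤M)) 2M≤N)))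
        (merge-odd j p q))))

-- On input ⌜ k ∷ l ⌝, where l is a prefix of ⟨p, q⟩, it answers
-- digit k ≠ 0 of the output at once (with 0), and digit 0 by searching, with
-- the budget of l, for a candidate pair (m, n) and outputting m.
module Realizer (aU aB : ℕ → ℕ) (eR : Code 2) where

  -- (m, n) is a candidate: R m n, x ∈ Uₘ and Bₙ ⊆ V are all confirmed within budget M.
  candidate : ℕ → ℕ → ℕ → ℕ → ℕ
  candidate M l m n = ifnz (run eR M (m ∷ n ∷ []))
                           (ifnz (accepts aU m M l evenEntries) (accepts aB n M l oddEntries) 0) 0

  search : ℕ → ℕ → ℕ
  search M l = firstNZ (λ m → ifnz (firstNZ (λ n → candidate M l m n) M) (suc m) 0) M

  realizer : ℕ → ℕ
  realizer c = ifnz (hd c) 1 (search (budget (tl c)) (tl c))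

  realizer-digit0 : ∀ l → realizer (cons 0 l) ≡ search (budget l) l
  realizer-digit0 l rewrite hd-cons 0 l | tl-cons 0 l = refl

  realizer-digitSuc : ∀ k → realizer ⌜ suc k ∷ [] ⌝ ≡ 1
  realizer-digitSuc k rewrite hd-cons (suc k) 0 = refl

  realizerᵖ : Computable 1 (uncurry₁ aU) → Computable 1 (uncurry₁ aB) → Computable 1 (uncurry₁ realizer)
  realizerᵖ aUᵖ aBᵖ = computable-ext (λ { (c ∷ []) → refl })
    (comp₃ ifnzᵖ hdᵖ (constᵖ 1) (comp₂ searchᵖ (comp₁ budgetᵖ tlᵖ) tlᵖ))
    where
    -- arguments n ∷ M ∷ l ∷ m
    candidateᵖ : Computable 4 (λ { (n ∷ M ∷ l ∷ m ∷ []) → candidate M l m n })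
    candidateᵖ = computable-ext (λ { (n ∷ M ∷ l ∷ m ∷ []) → refl })
      (comp₃ ifnzᵖ (compᵖ (runᵖ eR) (π1 ∷ᵖ π3 ∷ᵖ π0 ∷ᵖ []ᵖ))
         (comp₃ ifnzᵖ (comp₃ (acceptsᵖ aUᵖ evenEntriesᵖ) π1 π3 π2)
                      (comp₃ (acceptsᵖ aBᵖ oddEntriesᵖ) π1 π0 π2) (constᵖ 0))
         (constᵖ 0))
    searchᵖ : Computable 2 (uncurry₂ search)
    searchᵖ = computable-ext (λ { (M ∷ l ∷ []) → refl })
      (compᵖ
        (firstNZᵖ {v = λ { (m ∷ M ∷ l ∷ []) → ifnz (firstNZ (λ n → candidate M l m n) M) (suc m) 0 }}
          (computable-ext (λ { (m ∷ M ∷ l ∷ []) → refl })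
            (comp₃ ifnzᵖ (compᵖ (firstNZᵖ candidateᵖ) (π1 ∷ᵖ π1 ∷ᵖ π2 ∷ᵖ π0 ∷ᵖ []ᵖ))
                         (comp₁ sucᵖ π0) (constᵖ 0))))
        (π0 ∷ᵖ π0 ∷ᵖ π1 ∷ᵖ []ᵖ))

  search-sound : ∀ M l y → search M l ≡ suc y → ∃ λ n → candidate M l y n ≢ 0
  search-sound M l y e with firstNZ-sound _ M y e
  ... | m , _ , at , _ with firstNZ (λ n → candidate M l m n) M in eq
  ...   | suc z with at
  ...     | refl with firstNZ-sound _ M z eq
  ...       | n , _ , cn , _ = n , λ c≡0 → 0≢1+n (trans (sym c≡0) cn)

  search-complete : ∀ M l m n → m < M → n < M → candidate M l m n ≢ 0 → search M l ≢ 0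
  search-complete M l m n m<M n<M c≢0 = firstNZ-nonzero _ M m m<M m-succeeds
    where
    m-succeeds : ifnz (firstNZ (λ n' → candidate M l m n') M) (suc m) 0 ≢ 0
    m-succeeds with firstNZ (λ n' → candidate M l m n') M | firstNZ-nonzero (λ n' → candidate M l m n') M n n<M c≢0
    ... | zero  | nz = nz
    ... | suc _ | _  = λ ()

  candidate-sound : ∀ {M l m n} → candidate M l m n ≢ 0 →
    run eR M (m ∷ n ∷ []) ≢ 0 × accepts aU m M l evenEntries ≢ 0 × accepts aB n M l oddEntries ≢ 0
  candidate-sound {M} {l} {m} {n} c≢0
    with run eR M (m ∷ n ∷ []) | accepts aU m M l evenEntries | accepts aB n M l oddEntries
  ... | zero  | _     | _ = ⊥-elim (c≢0 refl)
  ... | suc _ | zero  | _ = ⊥-elim (c≢0 refl)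
  ... | suc _ | suc _ | b = (λ ()) , (λ ()) , c≢0

  candidate-complete : ∀ {M l m n} → run eR M (m ∷ n ∷ []) ≢ 0 → accepts aU m M l evenEntries ≢ 0 →
                       accepts aB n M l oddEntries ≢ 0 → candidate M l m n ≢ 0
  candidate-complete {M} {l} {m} {n} r≢0 u≢0 b≢0
    with run eR M (m ∷ n ∷ []) | accepts aU m M l evenEntries
  ... | zero  | _     = ⊥-elim (r≢0 refl)
  ... | suc _ | zero  = ⊥-elim (u≢0 refl)
  ... | suc _ | suc _ = b≢0

least-nonzero : ∀ (f : ℕ → ℕ) N → f N ≢ 0 → ∃ λ N* → ∃ λ y → f N* ≡ suc y × (∀ N' → N' < N* → f N' ≡ 0)
least-nonzero f N fN≢0 with firstNZ f (suc N) in eq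
... | zero = ⊥-elim (firstNZ-nonzero f (suc N) N ≤-refl fN≢0 eq)
... | suc y with firstNZ-sound f (suc N) y eq
...   | N* , _ , at , before = N* , y , at , before

module Correctness (X : RepSpace) (U B : ℕ → Subset X) (R : ℕ → ℕ → Set) (ercs : IsERCS X U B R) where
  open RepSpace X

  aU : Baire
  aU = proj₁ (proj₁ ercs)

  names-U : ∀ n p → p 0 ≡ n → ∃ λ r → AssocMap aU p r × NamesO X r (U n)
  names-U = proj₂ (proj₂ (proj₁ ercs))

  aB : Baire
  aB = proj₁ (proj₁ (proj₂ ercs))

  names-B : ∀ n p → p 0 ≡ n → ∃ λ r → AssocMap aB p r × NamesK X r (B n)
  names-B = proj₂ (proj₂ (proj₁ (proj₂ ercs)))

  eR : Code 2
  eR = proj₁ (proj₁ (proj₂ (proj₂ ercs)))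

  R-enumerated : ∀ m n → (R m n → ∃ λ y → Eval eR (m ∷ n ∷ []) y) × ((∃ λ y → Eval eR (m ∷ n ∷ []) y) → R m n)
  R-enumerated = proj₂ (proj₁ (proj₂ (proj₂ ercs)))

  U⊆B : ∀ m n → R m n → ∀ z → U m z → B n z
  U⊆B = proj₁ (proj₂ (proj₂ (proj₂ ercs)))

  covering : ∀ V → IsOpen X V → ∀ x → V x → ∃ λ n → (∀ z → B n z → V z) × ∃ λ m → R m n × U m x
  covering V V-open x = proj₁ (proj₂ (proj₂ (proj₂ (proj₂ ercs))) V V-open x)

  open Realizer aU aB eR public

  realizer-computable : ComputableBaire realizer
  realizer-computable = computable→baire (realizerᵖ (baire→computable (proj₁ (proj₂ (proj₁ ercs))))
                                                    (baire→computable (proj₁ (proj₂ (proj₁ (proj₂ ercs))))))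

  R-confirmed : ∀ {M m n} → run eR M (m ∷ n ∷ []) ≢ 0 → R m n
  R-confirmed {M} {m} {n} r≢0 with run eR M (m ∷ n ∷ []) in eq
  ... | zero  = ⊥-elim (r≢0 refl)
  ... | suc y = proj₂ (R-enumerated m n) (y , run-sound eR M _ y eq)

  R-confirms : ∀ {m n} → R m n → Eventually (λ M → run eR M (m ∷ n ∷ []) ≢ 0)
  R-confirms {m} {n} Rmn with proj₁ (R-enumerated m n) Rmn
  ... | y , ev = eventually-map (λ e → subst (_≢ 0) (sym e) (λ ())) (run-complete ev)

  module _ {x : Carrier} {V : Subset X} {p q : Baire} (p↦x : p names x) (q↦V : NamesO X q V) where

    U-accepted : ∀ {M l m} → Presents M l evenEntries p → accepts aU m M l evenEntries ≢ 0 → U m x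
    U-accepted {M} {l} {m} presents acc with names-U m (λ _ → m) refl
    ... | r' , a↦r' , r'↦Uₘ with r'↦Uₘ p x p↦x
    ...   | r , p↦r , top⇒U , _ = top⇒U (Simulation.accepts-sound aU m r' a↦r' M l evenEntries p r p↦r presents acc)

    U-accepts : ∀ {m} → U m x → Eventually (λ M → ∀ l → Presents M l evenEntries p → accepts aU m M l evenEntries ≢ 0)
    U-accepts {m} x∈Uₘ with names-U m (λ _ → m) refl
    ... | r' , a↦r' , r'↦Uₘ with r'↦Uₘ p x p↦x
    ...   | r , p↦r , _ , U⇒top = eventually-map (λ acc l → acc l evenEntries)
                                    (Simulation.accepts-complete aU m r' a↦r' p r p↦r (U⇒top x∈Uₘ))

    B-accepted : ∀ {M l n} → Presents M l oddEntries q → accepts aB n M l oddEntries ≢ 0 → ∀ z → B n z → V z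
    B-accepted {M} {l} {n} presents acc with names-B n (λ _ → n) refl
    ... | h , a↦h , h↦Bₙ with h↦Bₙ q V q↦V
    ...   | r , q↦r , top⇒⊆ , _ = top⇒⊆ (Simulation.accepts-sound aB n h a↦h M l oddEntries q r q↦r presents acc)

    B-accepts : ∀ {n} → (∀ z → B n z → V z) →
                Eventually (λ M → ∀ l → Presents M l oddEntries q → accepts aB n M l oddEntries ≢ 0)
    B-accepts {n} Bₙ⊆V with names-B n (λ _ → n) refl
    ... | h , a↦h , h↦Bₙ with h↦Bₙ q V q↦V
    ...   | r , q↦r , _ , ⊆⇒top = eventually-map (λ acc l → acc l oddEntries)
                                    (Simulation.accepts-complete aB n h a↦h q r q↦r (⊆⇒top Bₙ⊆V))

    realizer-sound : ∀ N y → realizer ⌜ 0 ∷ prefix (merge p q) N ⌝ ≡ suc y → U y x × (∀ z → U y z → V z)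
    realizer-sound N y answer = from-candidate (search-sound M l y (trans (sym (realizer-digit0 l)) answer))
      where
      l : ℕ
      l = ⌜ prefix (merge p q) N ⌝
      M : ℕ
      M = budget l
      2M≤N : 2 * M ≤ N
      2M≤N = budget-sound (merge p q) N
      from-candidate : (∃ λ n → candidate M l y n ≢ 0) → U y x × (∀ z → U y z → V z)
      from-candidate (n , c≢0) with candidate-sound {M} {l} {y} {n} c≢0
      ... | r≢0 , u≢0 , b≢0 =
        U-accepted {M} {l} (presents-even p q N M 2M≤N) u≢0 ,
        λ z z∈Uy → B-accepted {M} {l} (presents-odd p q N M 2M≤N) b≢0 z (U⊆B y n (R-confirmed r≢0) z z∈Uy)

    candidate-exists : V x → ∃ λ m → ∃ λ n → Eventually (λ M → m < M × n < M ×
      (∀ l → Presents M l evenEntries p → Presents M l oddEntries q → candidate M l m n ≢ 0))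
    candidate-exists x∈V with covering V (q , q↦V) x x∈V
    ... | n , Bₙ⊆V , m , Rmn , x∈Uₘ = m , n , eventually-map
      (λ {M} (m<M , n<M , r≢0 , u≢0 , b≢0) →
         m<M , n<M , λ l on-p on-q → candidate-complete {M} {l} {m} {n} r≢0 (u≢0 l on-p) (b≢0 l on-q))
      (eventually-both (eventually-above (suc m)) (eventually-both (eventually-above (suc n))
      (eventually-both (R-confirms Rmn) (eventually-both (U-accepts x∈Uₘ) (B-accepts Bₙ⊆V)))))

    -- Completeness: for x ∈ V the prefix of ⟨p, q⟩ of length 2M₀ leads to an answer.
    realizer-complete : V x → ∃ λ N → realizer ⌜ 0 ∷ prefix (merge p q) N ⌝ ≢ 0
    realizer-complete x∈V with candidate-exists x∈V
    ... | m , n , M₀ , eventually with eventually (budget ⌜ prefix (merge p q) (2 * M₀) ⌝) (budget-complete (merge p q) M₀)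
    ...   | m<M , n<M , candidate-mn = 2 * M₀ , λ answer≡0 →
      search-complete M l m n m<M n<M (candidate-mn l (presents-even p q _ M 2M≤N) (presents-odd p q _ M 2M≤N))
        (trans (sym (realizer-digit0 l)) answer≡0)
      where
      l : ℕ
      l = ⌜ prefix (merge p q) (2 * M₀) ⌝
      M : ℕ
      M = budget l
      2M≤N : 2 * M ≤ 2 * M₀
      2M≤N = budget-sound (merge p q) (2 * M₀)

    realizer-correct : V x → ∃ λ r → AssocMap realizer (merge p q) r × U (r 0) x × (∀ z → U (r 0) z → V z)
    realizer-correct x∈V with realizer-complete x∈V
    ... | N , answered with least-nonzero (λ N → realizer ⌜ 0 ∷ prefix (merge p q) N ⌝) N answered
    ...   | N* , y , at , before = output , digits , realizer-sound N* y at
      where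
      output : Baire
      output zero = y
      output (suc _) = 0
      digits : AssocMap realizer (merge p q) output
      digits zero = N* , at , before
      digits (suc k) = 0 , realizer-digitSuc k , λ _ ()

proposition6 : (X : RepSpace) (U B : ℕ → Subset X) (R : ℕ → ℕ → Set) →
    IsERCS X U B R → IsEffectiveBasis X U
proposition6 X U B R ercs =
  proj₁ ercs , realizer , realizer-computable , λ x V p q p↦x q↦V x∈V → realizer-correct p↦x q↦V x∈V
  where open Correctness X U B R ercs
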